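{- Let $p$ be a prime and $k$ a positive integer. Put $c_0=\lceil p/(4k)\rceil$ and $r_0=c_0\cdot 4k-p$. If $4k+1\equiv 0 \pmod{r_0}$, then there exist positive integers $x,y,z$ with $$\frac{4}{p}=\frac{1}{x}+\frac{1}{y}+\frac{1}{z}.$$ -}

module Defs where

open import Data.Nat using (ℕ; suc; _+_; _*_; _∸_; NonZero)
open import Data.Nat.DivMod using (_/_)
open import Data.Nat.Properties using (m*n≢0)
open import Relation.Binary.PropositionalEquality using (_≡_)

⌈_/_⌉ : (m n : ℕ) → .{{NonZero n}} → ℕ
⌈ m / n ⌉ = (m + (n ∸ 1)) / n

ceilDiv4k : (p k : ℕ) → .{{NonZero k}} → ℕ
ceilDiv4k p k = ⌈ p / (4 * k) ⌉ {{m*n≢0 4 k}}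

-- 4/p = 1/x + 1/y + 1/z, cleared of denominators (x, y, z, p all positive):
-- 4·x·y·z = p·(y·z + x·z + x·y)
EgyptianFourOver : (p x y z : ℕ) → Set
EgyptianFourOver p x y z = 4 * x * y * z ≡ p * (y * z + x * z + x * y)

{-# OPTIONS --safe #-}
-- Put m = 4k and r = c m − p.  The triple x = c k, y = c k t, z = p k t solves
-- 4/p = 1/x + 1/y + 1/z as soon as r t = p + c: cleared of denominators the
-- equation becomes p (t + 1) + c = c m t.  So it suffices that r ∣ p + c, and
-- this follows from r ∣ m + 1 since c (m + 1) = r + (p + c).
module Submission where

open import Defs
open import Data.List using (_∷_; [])
open import Data.Nat using (ℕ; suc; _+_; _*_; _∸_; _>_; _≤_; NonZero; >-nonZero⁻¹)
open import Data.Nat.Divisibility using (_∣_; divides; quotient≢0; ∣-refl; ∣n⇒∣m*n; ∣m+n∣m⇒∣n)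
open import Data.Nat.DivMod using (_/_; _%_; m≡m%n+[m/n]*n; m%n<n)
open import Data.Nat.Primality using (Prime; prime⇒nonZero)
open import Data.Nat.Properties
  using (+-cancelʳ-≤; +-monoˡ-≤; +-comm; <⇒≤pred; m+[n∸m]≡n; m*n≢0; m*n≢0⇒m≢0; *-mono-<; module ≤-Reasoning)
open import Data.Nat.Tactic.RingSolver using (solve)
open import Data.Product using (Σ; _×_; _,_)
open import Relation.Binary.PropositionalEquality using (_≡_; cong; sym; subst; module ≡-Reasoning)

FourOverSolvable : ℕ → Set
FourOverSolvable p = Σ ℕ λ x → Σ ℕ λ y → Σ ℕ λ z →
  (x > 0) × (y > 0) × (z > 0) × EgyptianFourOver p x y z

+-nonZero : ∀ m n .{{_ : NonZero m}} → NonZero (m + n)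
+-nonZero (suc _) _ = _

m≤⌈m/n⌉*n : ∀ m n .{{_ : NonZero n}} → m ≤ ⌈ m / n ⌉ * n
m≤⌈m/n⌉*n m (suc n) = +-cancelʳ-≤ n m (q * suc n) (begin
  m + n                       ≡⟨ m≡m%n+[m/n]*n (m + n) (suc n) ⟩
  (m + n) % suc n + q * suc n ≤⟨ +-monoˡ-≤ (q * suc n) (<⇒≤pred (m%n<n (m + n) (suc n))) ⟩
  n + q * suc n               ≡⟨ +-comm n (q * suc n) ⟩
  q * suc n + n               ∎)
  where
  open ≤-Reasoning
  q : ℕ
  q = (m + n) / suc n

excess∣m+1⇒excess∣p+c : ∀ {p c m r} → c * m ≡ p + r → r ∣ m + 1 → r ∣ p + c
excess∣m+1⇒excess∣p+c {p} {c} {m} {r} cm≡p+r r∣m+1 =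
  ∣m+n∣m⇒∣n (subst (r ∣_) c[m+1]≡r+[p+c] (∣n⇒∣m*n c r∣m+1)) ∣-refl
  where
  open ≡-Reasoning
  c[m+1]≡r+[p+c] : c * (m + 1) ≡ r + (p + c)
  c[m+1]≡r+[p+c] = begin
    c * (m + 1) ≡⟨ solve (c ∷ m ∷ []) ⟩
    c * m + c   ≡⟨ cong (_+ c) cm≡p+r ⟩
    p + r + c   ≡⟨ solve (p ∷ r ∷ c ∷ []) ⟩
    r + (p + c) ∎

egyptianFourOver-ck-ckt-pkt : ∀ p k c t → p * suc t + c ≡ c * (4 * k) * t →
  EgyptianFourOver p (c * k) (c * k * t) (p * k * t)
egyptianFourOver-ck-ckt-pkt p k c t eq = begin
  4 * (c * k) * (c * k * t) * (p * k * t)               ≡⟨ solve (p ∷ k ∷ c ∷ t ∷ []) ⟩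
  c * k * k * t * p * (c * (4 * k) * t)                 ≡⟨ cong (c * k * k * t * p *_) (sym eq) ⟩
  c * k * k * t * p * (p * suc t + c)                   ≡⟨ solve (p ∷ k ∷ c ∷ t ∷ []) ⟩
  p * (c * k * t * (p * k * t) + c * k * (p * k * t) + c * k * (c * k * t)) ∎
  where open ≡-Reasoning

excess∣p+c⇒fourOverSolvable : ∀ {p k c r} .{{_ : NonZero p}} .{{_ : NonZero k}} →
  c * (4 * k) ≡ p + r → r ∣ p + c → FourOverSolvable p
excess∣p+c⇒fourOverSolvable {p} {k} {c} {r} c4k≡p+r r∣p+c@(divides t p+c≡t*r) =
  c * k , c * k * t , p * k * t , ck>0 , *-mono-< ck>0 t>0 , *-mono-< (*-mono-< p>0 k>0) t>0 ,
  egyptianFourOver-ck-ckt-pkt p k c t p[t+1]+c≡c4kt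
  where
  open ≡-Reasoning
  p>0 : p > 0
  p>0 = >-nonZero⁻¹ p
  k>0 : k > 0
  k>0 = >-nonZero⁻¹ k
  c>0 : c > 0
  c>0 = >-nonZero⁻¹ c {{m*n≢0⇒m≢0 c {{subst NonZero (sym c4k≡p+r) (+-nonZero p r)}}}}
  t>0 : t > 0
  t>0 = >-nonZero⁻¹ t {{quotient≢0 r∣p+c {{+-nonZero p c}}}}
  ck>0 : c * k > 0
  ck>0 = *-mono-< c>0 k>0
  p[t+1]+c≡c4kt : p * suc t + c ≡ c * (4 * k) * t
  p[t+1]+c≡c4kt = begin
    p * suc t + c     ≡⟨ solve (p ∷ t ∷ c ∷ []) ⟩
    p * t + (p + c)   ≡⟨ cong (p * t +_) p+c≡t*r ⟩
    p * t + t * r     ≡⟨ solve (p ∷ t ∷ r ∷ []) ⟩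
    (p + r) * t       ≡⟨ cong (_* t) (sym c4k≡p+r) ⟩
    c * (4 * k) * t   ∎

proposition2p2 : (p k : ℕ) → Prime p → .{{_ : NonZero k}} →
    ceilDiv4k p k * (4 * k) ∸ p ∣ 4 * k + 1 →
    Σ ℕ λ x → Σ ℕ λ y → Σ ℕ λ z →
      (x > 0) × (y > 0) × (z > 0) × EgyptianFourOver p x y z
proposition2p2 p k p-prime r₀∣4k+1 =
  excess∣p+c⇒fourOverSolvable {c = c₀} {{p≢0}} c₀4k≡p+r₀ (excess∣m+1⇒excess∣p+c c₀4k≡p+r₀ r₀∣4k+1)
  where
  p≢0 : NonZero p
  p≢0 = prime⇒nonZero p-prime
  c₀ : ℕ
  c₀ = ceilDiv4k p k
  c₀4k≡p+r₀ : c₀ * (4 * k) ≡ p + (c₀ * (4 * k) ∸ p)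
  c₀4k≡p+r₀ = sym (m+[n∸m]≡n (m≤⌈m/n⌉*n p (4 * k) {{m*n≢0 4 k}}))
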